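{- Let $n$ be a positive integer and $1\le i\le n$. If the statistic $\sigma\mapsto\sigma_i$ on $S_n$ is homomesic with respect to the Kreweras complement, then $i=n$, or $n$ is even and $i=n/2$.
   Context: A statistic $f$ is homomesic with respect to a bijection $\mathcal{X}$ of a finite set if there is a constant $c$ such that its average over every orbit of $\mathcal{X}$ equals $c$. Permutations are in one-line notation and composed right to left. Let $c=234\cdots n1\in S_n$ (i.e. $c(i)=i+1$ for $i<n$, $c(n)=1$). The Kreweras complement is $\mathcal{K}:S_n\to S_n$, $\mathcal{K}(\sigma)=c\circ\sigma^{ -1}$. -}

module Defs where

open import Data.Nat using (ℕ; zero; suc; _+_; _*_; _<_; NonZero)
open import Data.Nat.Properties using (+-assoc)
open import Data.Nat.DivMod using (_%_; m%n<n; %-distribˡ-+; m%n%n≡m%n; [m+n]%n≡m%n; m<n⇒m%n≡m)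
open import Data.Fin using (Fin; toℕ; fromℕ<)
open import Data.Fin.Properties using (toℕ-fromℕ<; toℕ-injective; toℕ<n)
open import Data.Fin.Permutation using (Permutation′; permutation; _⟨$⟩ʳ_; _⟨$⟩ˡ_; _∘ₚ_; flip; _≈_; id)
open import Data.List using (List; map; upTo)
open import Data.Nat.ListAction using (sum)
open import Data.Product using (Σ; _×_; ∃)
open import Relation.Nullary using (¬_)
open import Relation.Binary.PropositionalEquality using (_≡_; _≢_; refl; cong; trans; sym; module ≡-Reasoning)

iter : ∀ {A : Set} → (A → A) → ℕ → A → A
iter T zero    x = x
iter T (suc k) x = T (iter T k x)

IsOrbitSize : ∀ {A : Set} → (A → A → Set) → (A → A) → A → ℕ → Set
IsOrbitSize _≈ₐ_ T x ℓ =
  (0 < ℓ) × (iter T ℓ x ≈ₐ x) × (∀ m → 0 < m → m < ℓ → ¬ (iter T m x ≈ₐ x))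

orbitSum : ∀ {A : Set} → (A → A) → (A → ℕ) → A → ℕ → ℕ
orbitSum T f x ℓ = sum (map (λ k → f (iter T k x)) (upTo ℓ))

Homomesic : ∀ {A : Set} → (A → A → Set) → (A → A) → (A → ℕ) → Set
Homomesic {A} _≈ₐ_ T f =
  Σ ℕ λ p → Σ ℕ λ q → (q ≢ 0) ×
    (∀ (x : A) (ℓ : ℕ) → IsOrbitSize _≈ₐ_ T x ℓ → orbitSum T f x ℓ * q ≡ p * ℓ)

-- The long cycle c = 2 3 ⋯ n 1 on Fin n (0-indexed: j ↦ j+1 mod n).

shiftF : (m k : ℕ) → Fin (suc m) → Fin (suc m)
shiftF m k i = fromℕ< (m%n<n (toℕ i + k) (suc m))

private
  toℕ-shiftF : ∀ m k i → toℕ (shiftF m k i) ≡ (toℕ i + k) % suc m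
  toℕ-shiftF m k i = toℕ-fromℕ< (m%n<n (toℕ i + k) (suc m))

  shift-shift : ∀ m j k i → shiftF m k (shiftF m j i) ≡ shiftF m (j + k) i
  shift-shift m j k i = toℕ-injective (begin
      toℕ (shiftF m k (shiftF m j i))
    ≡⟨ toℕ-shiftF m k (shiftF m j i) ⟩
      (toℕ (shiftF m j i) + k) % n
    ≡⟨ cong (λ t → (t + k) % n) (toℕ-shiftF m j i) ⟩
      ((a + j) % n + k) % n
    ≡⟨ %-distribˡ-+ ((a + j) % n) k n ⟩
      ((a + j) % n % n + k % n) % n
    ≡⟨ cong (λ t → (t + k % n) % n) (m%n%n≡m%n (a + j) n) ⟩
      ((a + j) % n + k % n) % n
    ≡⟨ sym (%-distribˡ-+ (a + j) k n) ⟩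
      (a + j + k) % n
    ≡⟨ cong (_% n) (+-assoc a j k) ⟩
      (a + (j + k)) % n
    ≡⟨ sym (toℕ-shiftF m (j + k) i) ⟩
      toℕ (shiftF m (j + k) i) ∎)
    where
      open ≡-Reasoning
      n = suc m
      a = toℕ i

  shift-full : ∀ m i → shiftF m (suc m) i ≡ i
  shift-full m i = toℕ-injective (trans (toℕ-shiftF m (suc m) i)
    (trans ([m+n]%n≡m%n (toℕ i) (suc m)) (m<n⇒m%n≡m (toℕ<n i))))

  inv₁ : ∀ m i → shiftF m m (shiftF m 1 i) ≡ i
  inv₁ m i = trans (shift-shift m 1 m i) (shift-full m i)

  inv₂ : ∀ m i → shiftF m 1 (shiftF m m i) ≡ i
  inv₂ m i = trans (shift-shift m m 1 i)
    (trans (cong (λ t → shiftF m t i) (Data.Nat.Properties.+-comm m 1)) (shift-full m i))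
    where import Data.Nat.Properties

longCycle : ∀ n → Permutation′ n
longCycle zero    = id
longCycle (suc m) = permutation (shiftF m 1) (shiftF m m) (inv₂ m) (inv₁ m)

-- Kreweras complement  K(σ) = c ∘ σ⁻¹  (apply σ⁻¹ first, then c).
-- Note: stdlib's  π ∘ₚ ρ  means "first π, then ρ".

kreweras : ∀ {n} → Permutation′ n → Permutation′ n
kreweras {n} σ = flip σ ∘ₚ longCycle n

-- the statistic σ ↦ σ_i, with i given 0-indexed as j : Fin n (i = toℕ j + 1),
-- and value σ_i ∈ {1,…,n}
entryStat : ∀ {n} → Fin n → Permutation′ n → ℕ
entryStat j σ = suc (toℕ (σ ⟨$⟩ʳ j))

-- Rotations ρₐ : x ↦ x + a (mod n) satisfy 𝒦 ρₐ = ρ₁₋ₐ, so 𝒦 swaps ρₐ and ρ₁₋ₐ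
-- and every orbit through a rotation has size one or two. Homomesy then forces
-- σᵢ + (𝒦 σ)ᵢ to take the same value on every rotation, i.e. (with t = i − 1)
-- (t + a mod n) + (t + 1 − a mod n) is independent of a. At a = 0 it is 2t + 1
-- (when i < n); if 2i < n it is larger at a = i + 1, and if 2i > n it is
-- smaller at a = i, since the second residue vanishes there while the first
-- wraps around. Hence 2i = n.
module Submission where

open import Defs
open import Data.Nat using (ℕ; zero; suc; _+_; _*_; _∸_; _/_; _<_; _≤_; _%_; z≤n; s≤s; s≤s⁻¹; NonZero; ≢-nonZero; >-nonZero⁻¹)
open import Data.Nat.Properties
open import Data.Nat.DivMod using (%-distribˡ-+; m%n%n≡m%n; m%n≤m; m<n⇒m%n≡m; [m+kn]%n≡m%n; m*n%n≡0; m*n/n≡m; m≤n⇒[n∸m]%m≡n%m)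
open import Data.Nat.Divisibility using (_∣_; divides)
open import Data.Nat.Tactic.RingSolver using (solve-∀)
open import Data.Fin using (Fin; toℕ)
open import Data.Fin.Properties using (toℕ-fromℕ<; toℕ-injective; toℕ<n; all?) renaming (_≟_ to _≟ᶠ_)
open import Data.Fin.Permutation using (Permutation′; permutation; _⟨$⟩ʳ_; _≈_)
open import Data.Product using (_×_; _,_)
open import Function using (_∘_)
open import Data.Sum using (_⊎_; inj₁; inj₂)
open import Data.Empty using (⊥-elim)
open import Relation.Nullary using (¬_; Dec; yes; no)
open import Relation.Binary using (tri<; tri≈; tri>)
open import Relation.Binary.PropositionalEquality using (_≡_; cong; cong₂; trans; sym; module ≡-Reasoning)

module _ {A : Set} {_≈ₐ_ : A → A → Set} {T : A → A} {f : A → ℕ}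
         (fixed? : ∀ x → Dec (T x ≈ₐ x))
         (f-cong : ∀ {x y} → x ≈ₐ y → f x ≡ f y) where

  homomesic⇒involutive-pairSum-constant :
    Homomesic _≈ₐ_ T f → ∀ {x y} → T (T x) ≈ₐ x → T (T y) ≈ₐ y →
    f x + f (T x) ≡ f y + f (T y)
  homomesic⇒involutive-pairSum-constant (p , q , q≢0 , homo) {x} {y} x₂ y₂ =
    *-cancelʳ-≡ _ _ q {{≢-nonZero q≢0}} (trans (pairSum≡ x₂) (sym (pairSum≡ y₂)))
    where
    fixed⇒orbitSize₁ : ∀ {z} → T z ≈ₐ z → IsOrbitSize _≈ₐ_ T z 1
    fixed⇒orbitSize₁ Tz≈z = s≤s z≤n , Tz≈z , λ { zero () _ ; (suc _) _ (s≤s ()) }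

    swapped⇒orbitSize₂ : ∀ {z} → ¬ T z ≈ₐ z → T (T z) ≈ₐ z → IsOrbitSize _≈ₐ_ T z 2
    swapped⇒orbitSize₂ Tz≉z z₂ = s≤s z≤n , z₂ ,
      λ { zero () _ ; (suc zero) _ _ → Tz≉z ; (suc (suc _)) _ (s≤s (s≤s ())) }

    pairSum≡ : ∀ {z} → T (T z) ≈ₐ z → (f z + f (T z)) * q ≡ p * 2
    pairSum≡ {z} z₂ with fixed? z
    ... | no Tz≉z =
      trans (cong (λ s → (f z + s) * q) (sym (+-identityʳ (f (T z)))))
            (homo z 2 (swapped⇒orbitSize₂ Tz≉z z₂))
    ... | yes Tz≈z = begin
        (f z + f (T z)) * q  ≡⟨ cong (λ s → (f z + s) * q) (f-cong Tz≈z) ⟩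
        (f z + f z) * q      ≡⟨ *-distribʳ-+ q (f z) (f z) ⟩
        f z * q + f z * q    ≡⟨ cong₂ _+_ fz*q≡p fz*q≡p ⟩
        p + p                ≡⟨ cong (p +_) (sym (+-identityʳ p)) ⟩
        2 * p                ≡⟨ *-comm 2 p ⟩
        p * 2                ∎
      where
      open ≡-Reasoning
      fz*q≡p : f z * q ≡ p
      fz*q≡p = trans (cong (_* q) (sym (+-identityʳ (f z))))
                     (trans (homo z 1 (fixed⇒orbitSize₁ Tz≈z)) (*-identityʳ p))

_≈?_ : ∀ {n} (π ρ : Permutation′ n) → Dec (π ≈ ρ)
π ≈? ρ = all? (λ i → π ⟨$⟩ʳ i ≟ᶠ ρ ⟨$⟩ʳ i)

m≥n⇒m%n<m : ∀ {m n} .{{_ : NonZero n}} → n ≤ m → m % n < m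
m≥n⇒m%n<m {m} {n} n≤m = begin-strict
  m % n        ≡⟨ sym (m≤n⇒[n∸m]%m≡n%m n≤m) ⟩
  (m ∸ n) % n  ≤⟨ m%n≤m (m ∸ n) n ⟩
  m ∸ n        <⟨ ∸-monoʳ-< {m} {n} {0} (>-nonZero⁻¹ n) n≤m ⟩
  m            ∎
  where open ≤-Reasoning

-- (t + a) mod n + (t + 1 − a) mod n, with −a represented by m * a.
residueSum : (m t a : ℕ) → ℕ
residueSum m t a = (t + a) % suc m + (t + (m * a + 1)) % suc m

residueSum-zero : ∀ {m t} → t < m → residueSum m t 0 ≡ t + suc t
residueSum-zero {m} {t} t<m = cong₂ _+_
  (trans (cong (_% suc m) (+-identityʳ t)) (m<n⇒m%n≡m (m<n⇒m<1+n t<m)))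
  (begin
    (t + (m * 0 + 1)) % suc m ≡⟨ cong (λ r → (t + (r + 1)) % suc m) (*-zeroʳ m) ⟩
    (t + 1) % suc m           ≡⟨ cong (_% suc m) (+-comm t 1) ⟩
    suc t % suc m             ≡⟨ m<n⇒m%n≡m (s≤s t<m) ⟩
    suc t                     ∎)
  where open ≡-Reasoning

residueSum-beforeHalf : ∀ {m t} → suc t + suc t < suc m → t + suc t < residueSum m t (2 + t)
residueSum-beforeHalf {m} {t} 2i<n = begin-strict
  t + suc t              <⟨ +-monoʳ-< t (n<1+n (suc t)) ⟩
  t + (2 + t)            ≡⟨ sym (m<n⇒m%n≡m t+2+t<n) ⟩
  (t + (2 + t)) % suc m  ≤⟨ m≤m+n _ _ ⟩
  residueSum m t (2 + t) ∎
  where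
  open ≤-Reasoning
  t+2+t<n : t + (2 + t) < suc m
  t+2+t<n = ≤-trans (s≤s (≤-reflexive (+-suc t (suc t)))) 2i<n

residueSum-afterHalf : ∀ {m t} → suc m < suc t + suc t → residueSum m t (suc t) < t + suc t
residueSum-afterHalf {m} {t} n<2i = begin-strict
  residueSum m t (suc t)                  ≡⟨ cong ((t + suc t) % suc m +_) second≡0 ⟩
  (t + suc t) % suc m + 0                 ≡⟨ +-identityʳ _ ⟩
  (t + suc t) % suc m                     <⟨ m≥n⇒m%n<m (s≤s⁻¹ n<2i) ⟩
  t + suc t                               ∎
  where
  open ≤-Reasoning
  e : ∀ m t → t + (m * suc t + 1) ≡ suc t * suc m
  e = solve-∀
  second≡0 : (t + (m * suc t + 1)) % suc m ≡ 0
  second≡0 = trans (cong (_% suc m) (e m t)) (m*n%n≡0 (suc t) (suc m))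

residueSum-constant⇒centred : ∀ {m t} → t < m →
  (∀ a → residueSum m t a ≡ residueSum m t 0) → suc t + suc t ≡ suc m
residueSum-constant⇒centred {m} {t} t<m constant with <-cmp (suc t + suc t) (suc m)
... | tri≈ _ 2i≡n _ = 2i≡n
... | tri< 2i<n _ _ = ⊥-elim (<-irrefl (sym (trans (constant (2 + t)) (residueSum-zero t<m)))
                                       (residueSum-beforeHalf 2i<n))
... | tri> _ _ n<2i = ⊥-elim (<-irrefl (trans (constant (suc t)) (residueSum-zero t<m))
                                       (residueSum-afterHalf n<2i))

module Rotation (m : ℕ) where

  toℕ-shiftF : ∀ k i → toℕ (shiftF m k i) ≡ (toℕ i + k) % suc m
  toℕ-shiftF k i = toℕ-fromℕ< _

  shiftF-shiftF : ∀ j k i → shiftF m k (shiftF m j i) ≡ shiftF m (j + k) i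
  shiftF-shiftF j k i = toℕ-injective (begin
    toℕ (shiftF m k (shiftF m j i))  ≡⟨ toℕ-shiftF k (shiftF m j i) ⟩
    (toℕ (shiftF m j i) + k) % n      ≡⟨ cong (λ r → (r + k) % n) (toℕ-shiftF j i) ⟩
    ((toℕ i + j) % n + k) % n         ≡⟨ %-distribˡ-+ ((toℕ i + j) % n) k n ⟩
    ((toℕ i + j) % n % n + k % n) % n ≡⟨ cong (λ r → (r + k % n) % n) (m%n%n≡m%n (toℕ i + j) n) ⟩
    ((toℕ i + j) % n + k % n) % n     ≡⟨ sym (%-distribˡ-+ (toℕ i + j) k n) ⟩
    (toℕ i + j + k) % n               ≡⟨ cong (_% n) (+-assoc (toℕ i) j k) ⟩
    (toℕ i + (j + k)) % n             ≡⟨ sym (toℕ-shiftF (j + k) i) ⟩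
    toℕ (shiftF m (j + k) i)          ∎)
    where
    open ≡-Reasoning
    n = suc m

  shiftF-+* : ∀ k l i → shiftF m (k + l * suc m) i ≡ shiftF m k i
  shiftF-+* k l i = toℕ-injective (begin
    toℕ (shiftF m (k + l * suc m) i) ≡⟨ toℕ-shiftF (k + l * suc m) i ⟩
    (toℕ i + (k + l * suc m)) % suc m ≡⟨ cong (_% suc m) (sym (+-assoc (toℕ i) k (l * suc m))) ⟩
    (toℕ i + k + l * suc m) % suc m   ≡⟨ [m+kn]%n≡m%n (toℕ i + k) l (suc m) ⟩
    (toℕ i + k) % suc m               ≡⟨ sym (toℕ-shiftF k i) ⟩
    toℕ (shiftF m k i)                ∎)
    where open ≡-Reasoning

  shiftF-* : ∀ l i → shiftF m (l * suc m) i ≡ i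
  shiftF-* l i = toℕ-injective (trans (toℕ-shiftF (l * suc m) i)
    (trans ([m+kn]%n≡m%n (toℕ i) l (suc m)) (m<n⇒m%n≡m (toℕ<n i))))

  -- m * a ≡ −a (mod n) provides the inverse without truncated subtraction.
  rotation : ℕ → Permutation′ (suc m)
  rotation a = permutation (shiftF m a) (shiftF m (m * a))
    (inverse (m * a) a (e₁ m a)) (inverse a (m * a) (e₂ m a))
    where
    inverse : ∀ b c → b + c ≡ a * suc m → ∀ i → shiftF m c (shiftF m b i) ≡ i
    inverse b c b+c≡an i =
      trans (shiftF-shiftF b c i) (trans (cong (λ s → shiftF m s i) b+c≡an) (shiftF-* a i))

    e₁ : ∀ m a → m * a + a ≡ a * suc m
    e₁ = solve-∀

    e₂ : ∀ m a → a + m * a ≡ a * suc m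
    e₂ = solve-∀

  kreweras-rotation : ∀ a → kreweras (rotation a) ≈ rotation (m * a + 1)
  kreweras-rotation a = shiftF-shiftF (m * a) 1

  -- 𝒦 (𝒦 σ) = c σ c⁻¹ holds definitionally, and rotations commute with c.
  kreweras-involutive-rotation : ∀ a → kreweras (kreweras (rotation a)) ≈ rotation a
  kreweras-involutive-rotation a i = begin
    shiftF m 1 (shiftF m a (shiftF m m i)) ≡⟨ cong (shiftF m 1) (shiftF-shiftF m a i) ⟩
    shiftF m 1 (shiftF m (m + a) i)       ≡⟨ shiftF-shiftF (m + a) 1 i ⟩
    shiftF m (m + a + 1) i                ≡⟨ cong (λ s → shiftF m s i) (e m a) ⟩
    shiftF m (a + 1 * suc m) i            ≡⟨ shiftF-+* a 1 i ⟩
    shiftF m a i                          ∎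
    where
    open ≡-Reasoning
    e : ∀ m a → m + a + 1 ≡ a + 1 * suc m
    e = solve-∀

  pairSum-rotation : ∀ j a → entryStat j (rotation a) + entryStat j (kreweras (rotation a))
                             ≡ 2 + residueSum m (toℕ j) a
  pairSum-rotation j a =
    trans (cong (λ s → entryStat j (rotation a) + suc (toℕ s)) (kreweras-rotation a j))
          (trans (cong₂ (λ r s → suc r + suc s) (toℕ-shiftF a j) (toℕ-shiftF (m * a + 1) j))
                 (cong suc (+-suc _ _)))

double⇒half : ∀ {n k} → k + k ≡ n → 2 ∣ n × k ≡ n / 2
double⇒half {n} {k} k+k≡n = divides k n≡k*2 , trans (sym (m*n/n≡m k 2)) (cong (_/ 2) (sym n≡k*2))
  where
  n≡k*2 : n ≡ k * 2
  n≡k*2 = trans (sym k+k≡n) (trans (cong (k +_) (sym (+-identityʳ k))) (*-comm 2 k))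

corollary7p21 : (n : ℕ) (j : Fin n) →
    Homomesic _≈_ kreweras (entryStat j) →
    (suc (toℕ j) ≡ n) ⊎ ((2 ∣ n) × (suc (toℕ j) ≡ n / 2))
corollary7p21 zero    ()
corollary7p21 (suc m) j homo with toℕ j ≟ m
... | yes t≡m = inj₁ (cong suc t≡m)
... | no  t≢m = inj₂ (double⇒half (residueSum-constant⇒centred t<m residueSum-constant))
  where
  open Rotation m
  t<m : toℕ j < m
  t<m = ≤∧≢⇒< (s≤s⁻¹ (toℕ<n j)) t≢m

  pairSum-constant : ∀ a → entryStat j (rotation a) + entryStat j (kreweras (rotation a))
                         ≡ entryStat j (rotation 0) + entryStat j (kreweras (rotation 0))
  pairSum-constant a =
    homomesic⇒involutive-pairSum-constant {_≈ₐ_ = _≈_}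
      (λ σ → kreweras σ ≈? σ) (λ σ≈τ → cong (suc ∘ toℕ) (σ≈τ j)) homo {rotation a} {rotation 0} (kreweras-involutive-rotation a) (kreweras-involutive-rotation 0)

  residueSum-constant : ∀ a → residueSum m (toℕ j) a ≡ residueSum m (toℕ j) 0
  residueSum-constant a = +-cancelˡ-≡ 2 _ _
    (trans (sym (pairSum-rotation j a)) (trans (pairSum-constant a) (pairSum-rotation j 0)))
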